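{- Let $U$ be a Milliken-Taylor ultrafilter on $\mathrm{FIN}$ and let $I$ be the ideal of all $X\subseteq\mathrm{FIN}$ for which there is $N\in\omega$ such that $x\cap N\neq\emptyset$ for every $x\in X$. Then $\prod_{n<\omega}(I,\subseteq)\le_T(U,\supseteq)$.
   Context: $\mathrm{FIN}=[\omega]^{<\omega}\setminus\{\emptyset\}$; $N\in\omega$ is identified with $\{0,\dots,N-1\}$. A block sequence is a sequence $\langle x_i\rangle$ in $\mathrm{FIN}$ with $\max(x_i)<\min(x_j)$ for $i<j$; $\mathrm{FIN}^{[\infty]}$ is the set of infinite block sequences. For $X=\langle x_i\rangle\in\mathrm{FIN}^{[\infty]}$, $[X]=\{\bigcup_{i\in F}x_i:F\in\mathrm{FIN}\}$; $X/m=\langle x_i:i\ge n\rangle$ with $n$ least such that $\min(x_n)>m$; $Y\le^*X$ iff $[Y/m]\subseteq[X]$ for some $m$. $U$ is Milliken-Taylor iff (1) every $A\in U$ contains some $[X]\in U$ with $X\in\mathrm{FIN}^{[\infty]}$, and (2) whenever $X_0\ge^*X_1\ge^*\cdots$ in $\mathrm{FIN}^{[\infty]}$ with all $[X_n]\in U$, there is $Y\in\mathrm{FIN}^{[\infty]}$ with $[Y]\in U$ and $X_n\ge^*Y$ for all $n$. The product is ordered coordinatewise. $P\le_TQ$ means there is $f:Q\to P$ mapping cofinal subsets of $Q$ to cofinal subsets of $P$. -}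

module Defs where

open import Data.Nat using (ℕ; suc; _<_; _≤_; _+_)
open import Data.List using (List; []; _∷_)
open import Data.List.Membership.Propositional using (_∈_)
open import Data.List.Relation.Unary.Linked using (Linked)
open import Data.Product using (Σ; _×_; _,_; ∃; proj₁)
open import Data.Sum using (_⊎_)
open import Data.Empty using (⊥)
open import Data.Unit using (⊤)
open import Relation.Nullary using (¬_)
open import Function.Bundles using (_⇔_)

-- FIN: nonempty finite subsets of ω, canonically represented as a
-- strictly increasing nonempty list  m ∷ xs  (m = min).

FIN : Set
FIN = Σ ℕ λ m → Σ (List ℕ) λ xs → Linked _<_ (m ∷ xs)

elems : FIN → List ℕ
elems (m , xs , _) = m ∷ xs

_∈ᶠ_ : ℕ → FIN → Set
k ∈ᶠ x = k ∈ elems x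

minᶠ : FIN → ℕ
minᶠ (m , _ , _) = m

lastOf : ℕ → List ℕ → ℕ
lastOf m []       = m
lastOf m (y ∷ ys) = lastOf y ys

maxᶠ : FIN → ℕ
maxᶠ (m , xs , _) = lastOf m xs

Subset : Set₁
Subset = FIN → Set

_⊆_ : Subset → Subset → Set
A ⊆ B = ∀ x → A x → B x

_∩_ : Subset → Subset → Subset
(A ∩ B) x = A x × B x

∁ : Subset → Subset
∁ A x = ¬ A x

IsBlock : (ℕ → FIN) → Set
IsBlock X = ∀ i j → i < j → maxᶠ (X i) < minᶠ (X j)

FIN∞ : Set
FIN∞ = Σ (ℕ → FIN) IsBlock

-- [X] = { ⋃_{i∈F} x_i : F ∈ FIN }  (z is the union iff it has the same elements)
span : (ℕ → FIN) → Subset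
span X z = Σ FIN λ F → ∀ k → (k ∈ᶠ z ⇔ Σ ℕ λ i → (i ∈ᶠ F) × (k ∈ᶠ X i))

[_] : FIN∞ → Subset
[ X ] = span (proj₁ X)

shift : (ℕ → FIN) → ℕ → (ℕ → FIN)
shift X n i = X (n + i)

-- n is least with min(x_n) > m, i.e. X/m = shift X n
IsCut : (ℕ → FIN) → ℕ → ℕ → Set
IsCut X m n = (m < minᶠ (X n)) × (∀ k → k < n → minᶠ (X k) ≤ m)

-- Y ≤* X  iff  [Y/m] ⊆ [X] for some m
_≤*_ : FIN∞ → FIN∞ → Set
Y ≤* X = Σ ℕ λ m → Σ ℕ λ n → IsCut (proj₁ Y) m n × (span (shift (proj₁ Y) n) ⊆ [ X ])

record IsUltrafilter (U : Subset → Set) : Set₁ where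
  field
    whole     : U (λ _ → ⊤)
    no-empty  : ¬ U (λ _ → ⊥)
    upward    : ∀ A B → A ⊆ B → U A → U B
    inter     : ∀ A B → U A → U B → U (A ∩ B)
    ultra     : ∀ A → U A ⊎ U (∁ A)

record IsMillikenTaylor (U : Subset → Set) : Set₁ where
  field
    ultrafilter : IsUltrafilter U
    cond1 : ∀ A → U A → Σ FIN∞ λ X → U [ X ] × ([ X ] ⊆ A)
    cond2 : (Xs : ℕ → FIN∞) → (∀ n → Xs (suc n) ≤* Xs n) → (∀ n → U [ Xs n ]) →
            Σ FIN∞ λ Y → U [ Y ] × (∀ n → Y ≤* Xs n)

InI : Subset → Set
InI X = Σ ℕ λ N → ∀ x → X x → ¬ (∀ k → k < N → ¬ (k ∈ᶠ x))

record Poset' : Set₂ where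
  field
    Carrier : Set₁
    _≼_     : Carrier → Carrier → Set

open Poset'

Cofinal : (P : Poset') → (Carrier P → Set) → Set₁
Cofinal P C = ∀ p → Σ (Carrier P) λ q → C q × _≼_ P p q

ImageCofinal : (P Q : Poset') → (Carrier Q → Carrier P) → (Carrier Q → Set) → Set₁
ImageCofinal P Q f C = ∀ p → Σ (Carrier Q) λ q → C q × _≼_ P p (f q)

_≤T_ : Poset' → Poset' → Set₁
P ≤T Q = Σ (Carrier Q → Carrier P) λ f → ∀ C → Cofinal Q C → ImageCofinal P Q f C

UPoset : (Subset → Set) → Poset'
UPoset U = record { Carrier = Σ Subset U ; _≼_ = λ A B → proj₁ B ⊆ proj₁ A }

ProdI : Poset'
ProdI = record { Carrier = Σ (ℕ → Subset) (λ s → ∀ n → InI (s n))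
               ; _≼_ = λ s t → ∀ n → proj₁ s n ⊆ proj₁ t n }

module Submission where

open import Defs
open import Data.Nat using (ℕ; zero; suc; _<_; _≤_; _+_; z≤n; s≤s)
open import Data.Nat.Properties
open import Data.List using ([]; _∷_; _++_)
open import Data.List.Membership.Propositional using (_∈_)
open import Data.List.Membership.Propositional.Properties using (∈-++⁺ˡ; ∈-++⁺ʳ; ∈-++⁻)
open import Data.List.Relation.Unary.Any using (here; there)
open import Data.List.Relation.Unary.Linked using (Linked; [-]; _∷_)
open import Data.Product using (Σ; _×_; _,_; proj₁; proj₂)
open import Data.Sum using (_⊎_; inj₁; inj₂)
open import Data.Empty using (⊥-elim)
open import Relation.Nullary using (¬_)
open import Relation.Binary.PropositionalEquality using (_≡_; refl; subst)
open import Function.Bundles using (mk⇔)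

-- Send A ∈ U to the sequence n ↦ Beyond A n of the x lying above every y ∈ A with
-- n ≤ min y.  It lands in I: A contains some [X], and its block y = x_n has n ≤ min y,
-- so every x ∈ Beyond A n has min x ≤ max y.  For cofinality, if each s n meets h n,
-- then the set of y with h n ≤ max y for all n ≤ min y meets every [X] (in x₀ ∪ x_j for
-- j large), hence is in U; any A ∈ U below it has s n ⊆ Beyond A n.  Only condition (1)
-- of the Milliken–Taylor property is needed.

min≤lastOf : ∀ m xs → Linked _<_ (m ∷ xs) → m ≤ lastOf m xs
min≤lastOf m []       _           = ≤-refl
min≤lastOf m (y ∷ ys) (m<y ∷ l) = ≤-trans (<⇒≤ m<y) (min≤lastOf y ys l)

min≤∈ : ∀ {m xs k} → Linked _<_ (m ∷ xs) → k ∈ m ∷ xs → m ≤ k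
min≤∈                 _         (here refl) = ≤-refl
min≤∈ {xs = _ ∷ _} (m<y ∷ l) (there k∈)  = ≤-trans (<⇒≤ m<y) (min≤∈ l k∈)

++-linked : ∀ m xs m′ ys → Linked _<_ (m ∷ xs) → lastOf m xs < m′ →
            Linked _<_ (m′ ∷ ys) → Linked _<_ (m ∷ xs ++ m′ ∷ ys)
++-linked m []       m′ ys _         lt l′ = lt ∷ l′
++-linked m (y ∷ xs) m′ ys (m<y ∷ l) lt l′ = m<y ∷ ++-linked y xs m′ ys l lt l′

lastOf-++ : ∀ m xs m′ ys → lastOf m (xs ++ m′ ∷ ys) ≡ lastOf m′ ys
lastOf-++ m []       m′ ys = refl
lastOf-++ m (y ∷ xs) m′ ys = lastOf-++ y xs m′ ys

minᶠ≤maxᶠ : ∀ x → minᶠ x ≤ maxᶠ x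
minᶠ≤maxᶠ (m , xs , l) = min≤lastOf m xs l

minᶠ-least : ∀ x {k} → k ∈ᶠ x → minᶠ x ≤ k
minᶠ-least (m , xs , l) = min≤∈ l

minᶠ∈ᶠ : ∀ x → minᶠ x ∈ᶠ x
minᶠ∈ᶠ (m , xs , l) = here refl

unionᶠ : (a c : FIN) → maxᶠ a < minᶠ c → FIN
unionᶠ (m , xs , l) (m′ , ys , l′) lt = m , xs ++ m′ ∷ ys , ++-linked m xs m′ ys l lt l′

minᶠ-unionᶠ : ∀ a c lt → minᶠ (unionᶠ a c lt) ≡ minᶠ a
minᶠ-unionᶠ (m , xs , l) (m′ , ys , l′) lt = refl

maxᶠ-unionᶠ : ∀ a c lt → maxᶠ (unionᶠ a c lt) ≡ maxᶠ c
maxᶠ-unionᶠ (m , xs , l) (m′ , ys , l′) lt = lastOf-++ m xs m′ ys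

∈-unionᶠ⁻ : ∀ a c lt {k} → k ∈ᶠ unionᶠ a c lt → k ∈ᶠ a ⊎ k ∈ᶠ c
∈-unionᶠ⁻ (m , xs , l) (m′ , ys , l′) lt = ∈-++⁻ (m ∷ xs)

∈-unionᶠ⁺ˡ : ∀ a c lt {k} → k ∈ᶠ a → k ∈ᶠ unionᶠ a c lt
∈-unionᶠ⁺ˡ (m , xs , l) (m′ , ys , l′) lt = ∈-++⁺ˡ

∈-unionᶠ⁺ʳ : ∀ a c lt {k} → k ∈ᶠ c → k ∈ᶠ unionᶠ a c lt
∈-unionᶠ⁺ʳ (m , xs , l) (m′ , ys , l′) lt = ∈-++⁺ʳ (m ∷ xs)

MeetsBelow : ℕ → FIN → Set
MeetsBelow N x = ¬ (∀ k → k < N → ¬ (k ∈ᶠ x))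

minᶠ<⇒meetsBelow : ∀ {N} x → minᶠ x < N → MeetsBelow N x
minᶠ<⇒meetsBelow x min<N avoid = avoid (minᶠ x) min<N (minᶠ∈ᶠ x)

meetsBelow⇒minᶠ< : ∀ {N} x → MeetsBelow N x → minᶠ x < N
meetsBelow⇒minᶠ< x meets = ≰⇒> λ N≤min →
  meets λ k k<N k∈x → <-irrefl refl (<-≤-trans k<N (≤-trans N≤min (minᶠ-least x k∈x)))

index≤minᶠ : (X : FIN∞) → ∀ j → j ≤ minᶠ (proj₁ X j)
index≤minᶠ X       zero    = z≤n
index≤minᶠ (X , b) (suc j) =
  ≤-trans (s≤s (≤-trans (index≤minᶠ (X , b) j) (minᶠ≤maxᶠ (X j)))) (b j (suc j) ≤-refl)

block∈span : (X : FIN∞) → ∀ n → [ X ] (proj₁ X n)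
block∈span X n = (n , [] , [-]) , λ k → mk⇔ (λ k∈ → n , here refl , k∈) λ { (_ , here refl , k∈) → k∈ }

firstUnion : (X : FIN∞) → ∀ j → FIN
firstUnion (X , b) j = unionᶠ (X 0) (X (suc j)) (b 0 (suc j) (s≤s z≤n))

firstUnion∈span : (X : FIN∞) → ∀ j → [ X ] (firstUnion X j)
firstUnion∈span (X , b) j = (0 , suc j ∷ [] , s≤s z≤n ∷ [-]) , λ k → mk⇔ to from
  where
  lt = b 0 (suc j) (s≤s z≤n)
  to : ∀ {k} → k ∈ᶠ unionᶠ (X 0) (X (suc j)) lt → Σ ℕ λ i → i ∈ 0 ∷ suc j ∷ [] × k ∈ᶠ X i
  to k∈ with ∈-unionᶠ⁻ (X 0) (X (suc j)) lt k∈
  ... | inj₁ k∈₀ = 0 , here refl , k∈₀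
  ... | inj₂ k∈ⱼ = suc j , there (here refl) , k∈ⱼ
  from : ∀ {k} → (Σ ℕ λ i → i ∈ 0 ∷ suc j ∷ [] × k ∈ᶠ X i) → k ∈ᶠ unionᶠ (X 0) (X (suc j)) lt
  from (_ , here refl ,         k∈) = ∈-unionᶠ⁺ˡ (X 0) (X (suc j)) lt k∈
  from (_ , there (here refl) , k∈) = ∈-unionᶠ⁺ʳ (X 0) (X (suc j)) lt k∈

prefixSum : (ℕ → ℕ) → ℕ → ℕ
prefixSum h zero    = h zero
prefixSum h (suc m) = prefixSum h m + h (suc m)

≤-prefixSum : ∀ h {n m} → n ≤ m → h n ≤ prefixSum h m
≤-prefixSum h {zero} {zero} z≤n = ≤-refl
≤-prefixSum h {n} {suc m} n≤1+m with m≤n⇒m<n∨m≡n n≤1+m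
... | inj₁ (s≤s n≤m) = ≤-trans (≤-prefixSum h n≤m) (m≤m+n (prefixSum h m) _)
... | inj₂ refl      = m≤n+m (h (suc m)) (prefixSum h m)

Dominating : (ℕ → ℕ) → Subset
Dominating h y = ∀ n → n ≤ minᶠ y → h n ≤ maxᶠ y

Beyond : Subset → ℕ → Subset
Beyond A n x = ∀ y → A y → ¬ (n ≤ minᶠ y × maxᶠ y < minᶠ x)

firstUnion-dominating : ∀ h (X : FIN∞) → Dominating h (firstUnion X (prefixSum h (minᶠ (proj₁ X 0))))
firstUnion-dominating h (X , b) n n≤min = begin
  h n                ≤⟨ ≤-prefixSum h (subst (n ≤_) (minᶠ-unionᶠ (X 0) (X (suc j)) lt) n≤min) ⟩
  j                  <⟨ n<1+n j ⟩
  suc j              ≤⟨ index≤minᶠ (X , b) (suc j) ⟩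
  minᶠ (X (suc j))   ≤⟨ minᶠ≤maxᶠ (X (suc j)) ⟩
  maxᶠ (X (suc j))   ≡⟨ maxᶠ-unionᶠ (X 0) (X (suc j)) lt ⟨
  maxᶠ (unionᶠ (X 0) (X (suc j)) lt) ∎
  where
  open ≤-Reasoning
  j  = prefixSum h (minᶠ (X 0))
  lt = b 0 (suc j) (s≤s z≤n)

beyond-span∈I : ∀ A (X : FIN∞) → [ X ] ⊆ A → ∀ n → InI (Beyond A n)
beyond-span∈I A X [X]⊆A n = suc (maxᶠ y) , λ x x∈ →
  minᶠ<⇒meetsBelow x (s≤s (≮⇒≥ λ y<x → x∈ y (y∈A) (index≤minᶠ X n , y<x)))
  where
  y   = proj₁ X n
  y∈A = [X]⊆A y (block∈span X n)

meetsBelow⇒beyond : ∀ {h A} → A ⊆ Dominating h → ∀ n x → MeetsBelow (h n) x → Beyond A n x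
meetsBelow⇒beyond A⊆D n x meets y y∈A (n≤min , max<x) =
  <-irrefl refl (<-trans (<-≤-trans (meetsBelow⇒minᶠ< x meets) (A⊆D y y∈A n n≤min)) max<x)

module _ (U : Subset → Set) (MT : IsMillikenTaylor U) where
  open IsMillikenTaylor MT
  open IsUltrafilter ultrafilter

  meets-spans⇒∈U : ∀ A → (∀ X → Σ FIN λ z → [ X ] z × A z) → U A
  meets-spans⇒∈U A meets with ultra A
  ... | inj₁ A∈U  = A∈U
  ... | inj₂ ∁A∈U with cond1 (∁ A) ∁A∈U
  ... | X , _ , [X]⊆∁A with meets X
  ... | z , z∈[X] , z∈A = ⊥-elim ([X]⊆∁A z z∈[X] z∈A)

  dominating∈U : ∀ h → U (Dominating h)
  dominating∈U h = meets-spans⇒∈U (Dominating h) λ X →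
    let j = prefixSum h (minᶠ (proj₁ X 0)) in
    firstUnion X j , firstUnion∈span X j , firstUnion-dominating h X

  beyond∈I : ∀ A → U A → ∀ n → InI (Beyond A n)
  beyond∈I A A∈U with cond1 A A∈U
  ... | X , _ , [X]⊆A = beyond-span∈I A X [X]⊆A

  tukeyMap : Poset'.Carrier (UPoset U) → Poset'.Carrier ProdI
  tukeyMap (A , A∈U) = Beyond A , beyond∈I A A∈U

corollary4p6 : (U : Subset → Set) → IsMillikenTaylor U → ProdI ≤T UPoset U
corollary4p6 U MT = tukeyMap U MT , λ C cofinal (s , s∈I) →
  let h = λ n → proj₁ (s∈I n)
      ((A , A∈U) , A∈C , A⊆D) = cofinal (Dominating h , dominating∈U U MT h)
  in (A , A∈U) , A∈C , λ n x x∈s → meetsBelow⇒beyond A⊆D n x (proj₂ (s∈I n) x x∈s)
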